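{- Let $G=(V,E)$ be a connected graph, $T=\{t_1,\dots,t_k\}\subseteq V$ a set of terminals, and let $C^r_1,\dots,C^r_k$ be as follows: $C^r_i$ is the connected component containing $t_i$ of $G-\big(C^r_1\cup\dots\cup C^r_{i-1}\cup\{t_{i+1},\dots,t_k\}\big)$. Let $M$ be a minimal edge multiway cut of $(G,T)$ and let $C_1,\dots,C_k$ be the connected components of $G-M$ with $t_i\in C_i$. Then $C_i\subseteq C^r_1\cup\dots\cup C^r_i$ for every $1\le i\le k$.
   Context: Graphs are finite, undirected, connected, without self-loops or parallel edges. An edge multiway cut of $(G,T)$ is a set $M\subseteq E$ such that in $G-M$ no two distinct terminals are joined by a path; it is minimal if no proper subset is one. For a minimal edge multiway cut $M$, $G-M$ has exactly $k$ components, the $i$-th containing $t_i$. -}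

module Defs where

open import Data.Nat using (ℕ; zero; suc; _<_)
open import Data.Fin using (Fin; toℕ)
open import Data.Bool using (Bool; true; false)
open import Data.Empty using (⊥)
open import Data.Sum using (_⊎_)
open import Data.Product using (_×_; Σ; ∃-syntax)
open import Relation.Nullary using (¬_)
open import Relation.Binary.PropositionalEquality using (_≡_; _≢_)

record Graph (n : ℕ) : Set where
  field
    adj   : Fin n → Fin n → Bool
    sym   : ∀ u v → adj u v ≡ adj v u
    irrefl : ∀ u → adj u u ≡ false
open Graph public

-- An edge set: symmetric Boolean relation (an unordered edge {u,v} is in
-- the set iff S u v ≡ true iff S v u ≡ true).
EdgeSet : ℕ → Set
EdgeSet n = Fin n → Fin n → Bool

IsSymmetric : ∀ {n} → EdgeSet n → Set
IsSymmetric S = ∀ u v → S u v ≡ S v u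

_⊆E_ : ∀ {n} → EdgeSet n → EdgeSet n → Set
S ⊆E S' = ∀ u v → S u v ≡ true → S' u v ≡ true

EdgesOf : ∀ {n} → Graph n → EdgeSet n
EdgesOf G = adj G

data WalkMinus {n} (G : Graph n) (M : EdgeSet n) : Fin n → Fin n → Set where
  here : ∀ {u} → WalkMinus G M u u
  step : ∀ {u w v} → adj G u w ≡ true → M u w ≡ false →
         WalkMinus G M w v → WalkMinus G M u v

noEdges : ∀ {n} → EdgeSet n
noEdges _ _ = false

Connected : ∀ {n} → Graph n → Set
Connected G = ∀ u v → WalkMinus G noEdges u v

data WalkIn {n} (G : Graph n) (P : Fin n → Set) : Fin n → Fin n → Set where
  here : ∀ {u} → P u → WalkIn G P u u
  step : ∀ {u w v} → P u → adj G u w ≡ true →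
         WalkIn G P w v → WalkIn G P u v

IsMultiwayCut : ∀ {n k} → Graph n → (Fin k → Fin n) → EdgeSet n → Set
IsMultiwayCut G t M =
  M ⊆E EdgesOf G × (∀ i j → i ≢ j → ¬ WalkMinus G M (t i) (t j))

IsMinimalMultiwayCut : ∀ {n k} → Graph n → (Fin k → Fin n) → EdgeSet n → Set
IsMinimalMultiwayCut G t M =
  IsSymmetric M × IsMultiwayCut G t M ×
  (∀ (M' : EdgeSet n) → IsSymmetric M' → M' ⊆E M →
     (∃[ u ] ∃[ v ] (M u v ≡ true × M' u v ≡ false)) →
     ¬ IsMultiwayCut G t M')
  where n = _

Comp : ∀ {n k} → Graph n → (Fin k → Fin n) → EdgeSet n → Fin k → Fin n → Set
Comp G t M i v = WalkMinus G M (t i) v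

-- Terminals are 0-indexed: terminal i (i : Fin k) is t_{i+1} of the paper.
-- RUnion G t m v : v ∈ C^r_1 ∪ ... ∪ C^r_m  (the first m reverse components)
-- CR G t i v      : v ∈ C^r_{i+1}, the component containing t i of
--   G - (C^r_1 ∪ ... ∪ C^r_i ∪ {t j | j > i}).
mutual
  RUnion : ∀ {n k} → Graph n → (Fin k → Fin n) → ℕ → Fin n → Set
  RUnion G t zero v = ⊥
  RUnion {k = k} G t (suc m) v = RUnion G t m v ⊎ CRn G t m v

  CRn : ∀ {n k} → Graph n → (Fin k → Fin n) → ℕ → Fin n → Set
  CRn {k = k} G t m v =
    Σ (Fin k) λ i → toℕ i ≡ m × WalkIn G (Allowed G t m) (t i) v

  Allowed : ∀ {n k} → Graph n → (Fin k → Fin n) → ℕ → Fin n → Set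
  Allowed G t m w = ¬ RUnion G t m w × (∀ j → m < toℕ j → w ≢ t j)

CR : ∀ {n k} → Graph n → (Fin k → Fin n) → Fin k → Fin n → Set
CR G t i v = WalkIn G (Allowed G t (toℕ i)) (t i) v

module Submission where

-- Write R_m = C^r_1 ∪ … ∪ C^r_m (RUnion G t m).  The key
-- structural fact is that R_m is closed under adjacency except at the
-- terminals t_l with l ≥ m: an edge leaving R_m can only end in such a
-- terminal (a neighbour of C^r_m that is neither in R_{m-1} nor a later
-- terminal was an allowed vertex, hence already lies in C^r_m).  Now t_i lies
-- in R_{i+1}, and a walk in G - M starting at t_i can only leave R_{i+1} by
-- stepping onto some t_l with l > i — which would join t_i and t_l in G - M,
-- contradicting that M is a multiway cut.  Hence C_i ⊆ R_{i+1}.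
--
-- The case analysis "is w in R_m?" is constructive only because membership in
-- R_m is decidable; this in turn rests on the decidability of reachability in
-- an induced subgraph G[P] for decidable P, proved by well-founded induction
-- on the set of usable vertices.

open import Defs hiding (sym)
open import Data.Nat using (ℕ; zero; suc; _≤_; _≤?_)
open import Data.Nat.Properties using (<-irrefl; ≤∧≢⇒<) renaming (_≟_ to _≟ℕ_)
open import Data.Fin using (Fin; toℕ)
open import Data.Fin.Properties using (any?) renaming (_≟_ to _≟F_)
open import Data.Fin.Subset using (Subset; _∈_; _-_; _⊂_; ⊤)
open import Data.Fin.Subset.Properties
  using (_∈?_; ∈⊤; p─q⊆p; x∈p∧x≢y⇒x∈p-y; x∈p⇒p-x⊂p)
open import Data.Fin.Subset.Induction using (⊂-wellFounded)
open import Induction.WellFounded using (Acc; acc)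
open import Data.Bool using (true)
open import Data.Bool.Properties using () renaming (_≟_ to _≟B_)
open import Data.Empty using (⊥; ⊥-elim)
open import Data.Sum using (_⊎_; inj₁; inj₂)
open import Data.Product using (_×_; Σ; _,_; proj₁; proj₂)
open import Relation.Nullary using (¬_; Dec; yes; no)
open import Relation.Nullary.Decidable using (_×-dec_; map′)
open import Level using (0ℓ)
open import Relation.Unary using (Pred; Decidable)
open import Function.Definitions using (Injective)
open import Relation.Binary.PropositionalEquality
  using (_≡_; _≢_; refl; sym; cong; subst)

module Walks {n : ℕ} (G : Graph n) where

  walkMap : ∀ {P Q : Pred (Fin n) 0ℓ} → (∀ {v} → P v → Q v) →
            ∀ {a b} → WalkIn G P a b → WalkIn G Q a b
  walkMap f (here p)     = here (f p)
  walkMap f (step p e w) = step (f p) e (walkMap f w)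

  walkHead : ∀ {P : Pred (Fin n) 0ℓ} {a b} → WalkIn G P a b → P a
  walkHead (here p)     = p
  walkHead (step p _ _) = p

  snoc : ∀ {P : Pred (Fin n) 0ℓ} {a u w} →
         WalkIn G P a u → adj G u w ≡ true → P w → WalkIn G P a w
  snoc (here pu)    e pw = step pu e (here pw)
  snoc (step p f r) e pw = step p f (snoc r e pw)

  _∖_ : Pred (Fin n) 0ℓ → Fin n → Pred (Fin n) 0ℓ
  (P ∖ a) v = P v × v ≢ a

  -- Shortcutting at a: a walk in G[P] ending at b ≠ a either avoids a, or
  -- (cutting it after its last visit of a) gives a neighbour of a from which
  -- b is reachable in G[P ∖ a].
  avoid : ∀ {P a x b} → b ≢ a → WalkIn G P x b →
          WalkIn G (P ∖ a) x b ⊎ Σ (Fin n) λ w → adj G a w ≡ true × WalkIn G (P ∖ a) w b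
  avoid b≢a (here p) = inj₁ (here (p , b≢a))
  avoid {a = a} b≢a (step {u = x} {w = y} p e r) with avoid b≢a r
  ... | inj₂ escape = inj₂ escape
  ... | inj₁ W with x ≟F a
  ...   | yes refl = inj₂ (y , e , W)
  ...   | no x≢a   = inj₁ (step (p , x≢a) e W)

module Reachability {n : ℕ} (G : Graph n) {P : Pred (Fin n) 0ℓ} (P? : Decidable P) where
  open Walks G

  Within : Subset n → Pred (Fin n) 0ℓ
  Within p v = v ∈ p × P v

  -- Reachability in G[Within p], by well-founded induction on p: either
  -- a = b, or b is reachable from a neighbour of a inside G[Within (p - a)].
  decWithin : ∀ p → Acc _⊂_ p → ∀ a b → Dec (WalkIn G (Within p) a b)
  decWithin p (acc smaller) a b with a ∈? p ×-dec P? a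
  ... | no a∉ = no (λ W → a∉ (walkHead W))
  ... | yes a∈ with a ≟F b
  ...   | yes refl = yes (here a∈)
  ...   | no a≢b with any? (λ w → (adj G a w ≟B true) ×-dec
                           decWithin (p - a) (smaller (x∈p⇒p-x⊂p (proj₁ a∈))) w b)
  ...     | yes (w , e , W) = yes (step a∈ e (walkMap shrink W))
    where
      shrink : ∀ {v} → Within (p - a) v → Within p v
      shrink (v∈ , pv) = p─q⊆p p _ v∈ , pv
  ...     | no ¬escape = no (λ W → refute (avoid (λ b≡a → a≢b (sym b≡a)) W))
    where
      grow : ∀ {v} → (Within p ∖ a) v → Within (p - a) v
      grow ((v∈ , pv) , v≢a) = x∈p∧x≢y⇒x∈p-y v∈ v≢a , pv

      refute : WalkIn G (Within p ∖ a) a b ⊎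
               Σ (Fin n) (λ w → adj G a w ≡ true × WalkIn G (Within p ∖ a) w b) → ⊥
      refute (inj₁ W)           = proj₂ (walkHead W) refl
      refute (inj₂ (w , e , W)) = ¬escape (w , e , walkMap grow W)

  decWalk : ∀ a b → Dec (WalkIn G P a b)
  decWalk a b = map′ (walkMap proj₂) (walkMap (λ pv → ∈⊤ , pv))
                     (decWithin ⊤ (⊂-wellFounded ⊤) a b)

module ReverseComponents {n k : ℕ} (G : Graph n) (t : Fin k → Fin n) where
  open Walks G

  TerminalFrom : ℕ → Pred (Fin n) 0ℓ
  TerminalFrom m w = Σ (Fin k) λ l → m ≤ toℕ l × w ≡ t l

  decTerminalFrom : ∀ m → Decidable (TerminalFrom m)
  decTerminalFrom m w = any? (λ l → (m ≤? toℕ l) ×-dec (w ≟F t l))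

  allowed : ∀ {m w} → ¬ RUnion G t m w → ¬ TerminalFrom (suc m) w → Allowed G t m w
  allowed ¬r ¬later = ¬r , λ j m<j w≡tj → ¬later (j , m<j , w≡tj)

  decRUnion  : ∀ m → Decidable (RUnion G t m)
  decAllowed : ∀ m → Decidable (Allowed G t m)
  decRUnion zero    w = no (λ ())
  decRUnion (suc m) w with decRUnion m w
  ... | yes r = yes (inj₁ r)
  ... | no ¬r with any? (λ i → (toℕ i ≟ℕ m) ×-dec
                         Reachability.decWalk G (decAllowed m) (t i) w)
  ...   | yes c = yes (inj₂ c)
  ...   | no ¬c = no λ { (inj₁ r) → ¬r r ; (inj₂ c) → ¬c c }
  decAllowed m w with decRUnion m w | decTerminalFrom (suc m) w
  ... | yes r  | _         = no (λ a → proj₁ a r)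
  ... | no ¬r  | yes later = no (λ a → allowed-excludes-later a later)
    where
      allowed-excludes-later : Allowed G t m w → TerminalFrom (suc m) w → ⊥
      allowed-excludes-later (_ , notLater) (j , m<j , w≡tj) = notLater j m<j w≡tj
  ... | no ¬r  | no ¬later = yes (allowed ¬r ¬later)

  -- For distinct terminals, t_i ∈ R_{i+1}: either it is already in R_i, or
  -- it is allowed (no later terminal equals it) and starts C^r_{i+1}.
  terminal∈RUnion : Injective _≡_ _≡_ t → ∀ i → RUnion G t (suc (toℕ i)) (t i)
  terminal∈RUnion inj i with decRUnion (toℕ i) (t i)
  ... | yes r = inj₁ r
  ... | no ¬r = inj₂ (i , refl , here (¬r , λ j i<j ti≡tj → <-irrefl (cong toℕ (inj ti≡tj)) i<j))

  RUnion-closed : Injective _≡_ _≡_ t → ∀ m {u w} → RUnion G t m u → adj G u w ≡ true →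
                  RUnion G t m w ⊎ TerminalFrom m w
  RUnion-closed inj zero () e
  RUnion-closed inj (suc m) (inj₁ r) e with RUnion-closed inj m r e
  ... | inj₁ r' = inj₁ (inj₁ r')
  ... | inj₂ (l , m≤l , w≡tl) with toℕ l ≟ℕ m
  ...   | yes refl = inj₁ (subst (RUnion G t (suc (toℕ l))) (sym w≡tl) (terminal∈RUnion inj l))
  ...   | no l≢m   = inj₂ (l , ≤∧≢⇒< m≤l (λ m≡l → l≢m (sym m≡l)) , w≡tl)
  RUnion-closed inj (suc m) {w = w} (inj₂ (i , i≡m , W)) e with decRUnion m w
  ... | yes r = inj₁ (inj₁ r)
  ... | no ¬r with decTerminalFrom (suc m) w
  ...   | yes later = inj₂ later
  ...   | no ¬later = inj₁ (inj₂ (i , i≡m , snoc W e (allowed ¬r ¬later)))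

module Escape {n : ℕ} (G : Graph n) (M : EdgeSet n) where

  stay-or-escape : ∀ {S B : Pred (Fin n) 0ℓ} →
    (∀ {u w} → S u → adj G u w ≡ true → S w ⊎ B w) →
    ∀ {x y} → S x → WalkMinus G M x y →
    S y ⊎ Σ (Fin n) λ w → B w × WalkMinus G M x w
  stay-or-escape closed sx here = inj₁ sx
  stay-or-escape closed sx (step e m rest) with closed sx e
  ... | inj₂ bw = inj₂ (_ , bw , step e m here)
  ... | inj₁ sw with stay-or-escape closed sw rest
  ...   | inj₁ sy             = inj₁ sy
  ...   | inj₂ (z , bz , w→z) = inj₂ (z , bz , step e m w→z)

lemma14 : ∀ {n k} (G : Graph n) (t : Fin k → Fin n) →
    Connected G → Injective _≡_ _≡_ t →
    (M : EdgeSet n) → IsMinimalMultiwayCut G t M →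
    ∀ (i : Fin k) (v : Fin n) → Comp G t M i v → RUnion G t (suc (toℕ i)) v
lemma14 G t _ inj M (_ , (_ , separates) , _) i v tᵢ→v
  with Escape.stay-or-escape G M (RUnion-closed inj (suc (toℕ i)))
                                 (terminal∈RUnion inj i) tᵢ→v
  where open ReverseComponents G t
... | inj₁ v∈R = v∈R
... | inj₂ (_ , (l , i<l , w≡tl) , tᵢ→w) =
  ⊥-elim (separates i l (λ i≡l → <-irrefl (cong toℕ i≡l) i<l)
                        (subst (WalkMinus G M (t i)) w≡tl tᵢ→w))
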